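{- Let $(G=(V,E),L,c,r,e_r)$ be a rooted WRAP instance, $K\subseteq L$, and $C\in\mathcal C_G$. Then $\delta_K(C)\ne\emptyset$ if and only if there is a vertex $v\in C$ that is connected to a vertex $w\in V\setminus C$ in the link intersection graph of $K$.
   Context: Rooted WRAP instance: cycle $G=(V,E)$, links $L\subseteq\binom V2$, costs $c$, root $r$, edge $e_r\in E$ at $r$. $\mathcal C_G=\{C\subseteq V\setminus\{r\}:|\delta_E(C)|=2\}$ (vertex sets of subpaths of $G$ avoiding $r$); $\delta_K(C)$ = links of $K$ with exactly one endpoint in $C$. Two links intersect if they share an endpoint or cross (share no endpoint and each of the two paths of $G$ between the endpoints of one contains an endpoint of the other). The link intersection graph of $K$ has vertex set $K$ and edges between intersecting links. A vertex $a$ is connected to a vertex $b$ in it if it contains a path from a link incident to $a$ to a link incident to $b$. -}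

module Defs where

open import Data.Nat using (ℕ; zero; suc; _≤_; _%_; _⊓_; _⊔_)
open import Data.Nat.DivMod using (m%n<n)
open import Data.Fin using (Fin; toℕ; fromℕ<)
open import Data.Bool using (Bool; true; false; _xor_; if_then_else_)
open import Data.Vec using (lookup)
open import Data.Fin.Subset using (Subset)
open import Data.List using (List; map; allFin)
open import Data.Nat.ListAction using (sum)
open import Data.List.Membership.Propositional using (_∈_)
open import Data.Product using (_×_; _,_; proj₁; proj₂; ∃; ∃-syntax)
open import Data.Sum using (_⊎_)
open import Relation.Binary.PropositionalEquality using (_≡_; _≢_)
open import Relation.Nullary using (¬_)

-- The cycle G on vertex set Fin n: vertex i is adjacent to next i = i+1 mod n.
-- Edge of G are indexed by Fin n: edge i = {i, next i}.
next : ∀ {n} → Fin n → Fin n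
next {suc m} i = fromℕ< (m%n<n (suc (toℕ i)) (suc m))

-- A link is a pair of vertices (unordered pair {u,v}, u ≠ v required separately).
Link : ℕ → Set
Link n = Fin n × Fin n

IsLink : ∀ {n} → Link n → Set
IsLink (u , v) = u ≢ v

EdgeAt : ∀ {n} → Fin n → Fin n → Set
EdgeAt r i = (i ≡ r) ⊎ (next i ≡ r)

cutSize : ∀ {n} → Subset n → ℕ
cutSize {n} C = sum (map (λ i → if lookup C i xor lookup C (next i) then 1 else 0) (allFin n))

InCG : ∀ {n} → Fin n → Subset n → Set
InCG r C = (lookup C r ≡ false) × (cutSize C ≡ 2)

DeltaNonempty : ∀ {n} → List (Link n) → Subset n → Set
DeltaNonempty K C = ∃[ ℓ ] (ℓ ∈ K × (lookup C (proj₁ ℓ) xor lookup C (proj₂ ℓ) ≡ true))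

-- The two paths of G between u and v (vertices listed in cyclic order 0..n-1).
minN maxN : ℕ → ℕ → ℕ
minN a b = a ⊓ b
maxN a b = a ⊔ b

OnPath₁ : ∀ {n} → Fin n → Fin n → Fin n → Set
OnPath₁ u v w = (minN (toℕ u) (toℕ v) ≤ toℕ w) × (toℕ w ≤ maxN (toℕ u) (toℕ v))

OnPath₂ : ∀ {n} → Fin n → Fin n → Fin n → Set
OnPath₂ u v w = (toℕ w ≤ minN (toℕ u) (toℕ v)) ⊎ (maxN (toℕ u) (toℕ v) ≤ toℕ w)

ShareEndpoint : ∀ {n} → Link n → Link n → Set
ShareEndpoint (u , v) (x , y) = (u ≡ x) ⊎ (u ≡ y) ⊎ (v ≡ x) ⊎ (v ≡ y)

Cross : ∀ {n} → Link n → Link n → Set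
Cross (u , v) (x , y) =
  ¬ ShareEndpoint (u , v) (x , y)
  × (OnPath₁ u v x ⊎ OnPath₁ u v y)
  × (OnPath₂ u v x ⊎ OnPath₂ u v y)

Intersect : ∀ {n} → Link n → Link n → Set
Intersect ℓ ℓ' = ShareEndpoint ℓ ℓ' ⊎ Cross ℓ ℓ'

data IGPath {n} (K : List (Link n)) : Link n → Link n → Set where
  here : ∀ {ℓ} → ℓ ∈ K → IGPath K ℓ ℓ
  step : ∀ {ℓ ℓ' ℓ''} → ℓ ∈ K → Intersect ℓ ℓ' → IGPath K ℓ' ℓ'' → IGPath K ℓ ℓ''

Incident : ∀ {n} → Fin n → Link n → Set
Incident a (u , v) = (a ≡ u) ⊎ (a ≡ v)

ConnectedIn : ∀ {n} → List (Link n) → Fin n → Fin n → Set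
ConnectedIn K a b = ∃[ ℓ ] ∃[ ℓ' ] (Incident a ℓ × Incident b ℓ' × IGPath K ℓ ℓ')

{-# OPTIONS --safe #-}
-- A link with both ends in C cannot intersect a link with both ends outside C:
-- a shared endpoint would be both in and out of C, and a crossing would make the
-- cycle, read from vertex 0, enter and leave C at least four times, while C has
-- only two boundary edges. So a path in the link intersection graph that starts at
-- a link touching C and ends at a link touching V ∖ C must contain a link of δ_K(C).
module Submission where

open import Defs
open import Data.Nat using (ℕ; zero; suc; _+_; _≤_; _<_; _⊓_; _⊔_; z≤n; s≤s)
open import Data.Nat.Properties
  using (≤-refl; ≤-trans; +-identityʳ; m<m+n; ≤-reflexive; <⇒≤; <⇒≱; m≤m+n; m≤n⇒m<n∨m≡n; ⊓-sel; ⊔-sel; module ≤-Reasoning)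
open import Data.Nat.DivMod using (m%n<n; n%n≡0; m<n⇒m%n≡m)
open import Data.Nat.ListAction using (sum)
open import Data.Nat.ListAction.Properties using (sum-++)
open import Data.Fin using (Fin; toℕ; fromℕ<)
open import Data.Fin.Properties using (toℕ-injective; toℕ-fromℕ<; toℕ<n)
open import Data.Fin.Subset using (Subset)
open import Data.Bool using (Bool; true; false; _xor_; if_then_else_)
open import Data.Bool.Properties using (¬-not) renaming (_≟_ to _≟ᵇ_)
open import Data.Vec using (lookup)
open import Data.List using (List; _∷_; _++_; [_]; applyUpTo; tabulate)
open import Data.List.Properties using (applyUpTo-∷ʳ; map-tabulate; tabulate-cong)
open import Data.List.Relation.Unary.All using (All)
open import Data.List.Relation.Binary.Subset.Propositional using (_⊆_)
open import Data.Product using (_×_; _,_; ∃-syntax)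
open import Data.Sum using (_⊎_; inj₁; inj₂)
open import Data.Empty using (⊥; ⊥-elim)
open import Data.Rational using (ℚ)
open import Function using (_∘_; id)
open import Function.Bundles using (_⇔_; mk⇔)
open import Relation.Nullary using (¬_; yes; no; contradiction)
open import Relation.Binary.PropositionalEquality
  using (_≡_; _≢_; refl; sym; trans; cong; subst; ≢-sym; module ≡-Reasoning)

≡true∧≡false⇒≢ : ∀ {a b : Bool} → a ≡ true → b ≡ false → a ≢ b
≡true∧≡false⇒≢ refl refl ()

tabulate-∘toℕ : ∀ {A : Set} k (f : ℕ → A) → tabulate (f ∘ toℕ {k}) ≡ applyUpTo f k
tabulate-∘toℕ zero    f = refl
tabulate-∘toℕ (suc k) f = cong (f 0 ∷_) (tabulate-∘toℕ k (f ∘ suc))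

change : Bool → Bool → ℕ
change a b = if a xor b then 1 else 0

change-≢ : ∀ {a b} → a ≢ b → change a b ≡ 1
change-≢ {true}  {true}  a≢b = contradiction refl a≢b
change-≢ {true}  {false} _   = refl
change-≢ {false} {true}  _   = refl
change-≢ {false} {false} a≢b = contradiction refl a≢b

changes : (ℕ → Bool) → ℕ → ℕ
changes g n = sum (applyUpTo (λ k → change (g k) (g (suc k))) n)

module _ (g : ℕ → Bool) where

  changes-suc : ∀ n → changes g (suc n) ≡ changes g n + change (g n) (g (suc n))
  changes-suc n = begin
    changes g (suc n)               ≡⟨ cong sum (sym (applyUpTo-∷ʳ f n)) ⟩
    sum (applyUpTo f n ++ [ f n ])  ≡⟨ sum-++ (applyUpTo f n) [ f n ] ⟩
    changes g n + (f n + 0)         ≡⟨ cong (changes g n +_) (+-identityʳ (f n)) ⟩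
    changes g n + f n               ∎
    where
    open ≡-Reasoning
    f : ℕ → ℕ
    f k = change (g k) (g (suc k))

  changes-≤-suc : ∀ n → changes g n ≤ changes g (suc n)
  changes-≤-suc n = ≤-trans (m≤m+n _ _) (≤-reflexive (sym (changes-suc n)))

  changes-mono : ∀ {a b} → a ≤ b → changes g a ≤ changes g b
  changes-mono {b = zero}  z≤n = ≤-refl
  changes-mono {b = suc b} a≤1+b with m≤n⇒m<n∨m≡n a≤1+b
  ... | inj₂ refl      = ≤-refl
  ... | inj₁ (s≤s a≤b) = ≤-trans (changes-mono a≤b) (changes-≤-suc b)

  changes-< : ∀ {a b} → a ≤ b → g a ≢ g b → changes g a < changes g b
  changes-< {b = zero}  z≤n ga≢gb = contradiction refl ga≢gb
  changes-< {a} {suc b} a≤1+b ga≢g1+b with m≤n⇒m<n∨m≡n a≤1+b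
  ... | inj₂ refl = contradiction refl ga≢g1+b
  ... | inj₁ (s≤s a≤b) with g a ≟ᵇ g b
  ...   | no ga≢gb  = ≤-trans (changes-< a≤b ga≢gb) (changes-≤-suc b)
  ...   | yes ga≡gb = begin-strict
    changes g a                             ≤⟨ changes-mono a≤b ⟩
    changes g b                             <⟨ m<m+n (changes g b) (s≤s z≤n) ⟩
    changes g b + 1                         ≡⟨ cong (changes g b +_) (sym (change-≢ (ga≢g1+b ∘ trans ga≡gb))) ⟩
    changes g b + change (g b) (g (suc b))  ≡⟨ sym (changes-suc b) ⟩
    changes g (suc b)                       ∎
    where open ≤-Reasoning

  three-changes : ∀ {p q r s} → p ≤ q → q ≤ r → r ≤ s → g p ≢ g q → g q ≢ g r → g r ≢ g s
    → 3 + changes g p ≤ changes g s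
  three-changes {p} {q} {r} {s} p≤q q≤r r≤s p≢q q≢r r≢s = begin
    3 + changes g p  ≤⟨ s≤s (s≤s (changes-< p≤q p≢q)) ⟩
    2 + changes g q  ≤⟨ s≤s (changes-< q≤r q≢r) ⟩
    1 + changes g r  ≤⟨ changes-< r≤s r≢s ⟩
    changes g s      ∎
    where open ≤-Reasoning

  -- If g n ≡ g 0, the fourth change is found either before p or after s.
  four-changes : ∀ {n p q r s} → p ≤ q → q ≤ r → r ≤ s → s ≤ n
    → g p ≢ g q → g q ≢ g r → g r ≢ g s → g n ≡ g 0 → 4 ≤ changes g n
  four-changes {n} {p} {q} {r} {s} p≤q q≤r r≤s s≤n p≢q q≢r r≢s gn≡g0 with g 0 ≟ᵇ g p
  ... | yes g0≡gp = begin
    4                ≤⟨ m≤m+n 4 (changes g p) ⟩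
    4 + changes g p  ≤⟨ s≤s (three-changes p≤q q≤r r≤s p≢q q≢r r≢s) ⟩
    1 + changes g s  ≤⟨ changes-< s≤n s≢n ⟩
    changes g n      ∎
    where
    open ≤-Reasoning
    p≡r : g p ≡ g r
    p≡r = trans (¬-not p≢q) (sym (¬-not (≢-sym q≢r)))
    s≢n : g s ≢ g n
    s≢n gs≡gn = r≢s (trans (sym p≡r) (trans (sym g0≡gp) (trans (sym gn≡g0) (sym gs≡gn))))
  ... | no g0≢gp = begin
    4                ≤⟨ s≤s (s≤s (s≤s (changes-< z≤n g0≢gp))) ⟩
    3 + changes g p  ≤⟨ three-changes p≤q q≤r r≤s p≢q q≢r r≢s ⟩
    changes g s      ≤⟨ changes-mono s≤n ⟩
    changes g n      ∎
    where open ≤-Reasoning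

Inside Outside : ∀ {n} → Subset n → Link n → Set
Inside  C (x , y) = lookup C x ≡ true  × lookup C y ≡ true
Outside C (x , y) = lookup C x ≡ false × lookup C y ≡ false

Cuts : ∀ {n} → Subset n → Link n → Set
Cuts C (x , y) = (lookup C x xor lookup C y) ≡ true

ConnectsAcross : ∀ {n} → List (Link n) → Subset n → Set
ConnectsAcross K C = ∃[ v ] ∃[ w ] (lookup C v ≡ true × lookup C w ≡ false × ConnectedIn K v w)

link-position : ∀ {n} (C : Subset n) ℓ → Inside C ℓ ⊎ Outside C ℓ ⊎ Cuts C ℓ
link-position C (x , y) with lookup C x | lookup C y
... | true  | true  = inj₁ (refl , refl)
... | false | false = inj₂ (inj₁ (refl , refl))
... | true  | false = inj₂ (inj₂ refl)
... | false | true  = inj₂ (inj₂ refl)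

incident-in⇒¬Outside : ∀ {n} {C : Subset n} {a ℓ} → lookup C a ≡ true → Incident a ℓ → ¬ Outside C ℓ
incident-in⇒¬Outside Ca (inj₁ refl) (Cx , _) = ≡true∧≡false⇒≢ Ca Cx refl
incident-in⇒¬Outside Ca (inj₂ refl) (_ , Cy) = ≡true∧≡false⇒≢ Ca Cy refl

incident-out⇒¬Inside : ∀ {n} {C : Subset n} {a ℓ} → lookup C a ≡ false → Incident a ℓ → ¬ Inside C ℓ
incident-out⇒¬Inside Ca (inj₁ refl) (Cx , _) = ≡true∧≡false⇒≢ Cx Ca refl
incident-out⇒¬Inside Ca (inj₂ refl) (_ , Cy) = ≡true∧≡false⇒≢ Cy Ca refl

in-out-≢ : ∀ {n} {C : Subset n} {a b} → lookup C a ≡ true → lookup C b ≡ false → a ≢ b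
in-out-≢ {C = C} Ca Cb a≡b = ≡true∧≡false⇒≢ Ca Cb (cong (lookup C) a≡b)

Inside∧ShareEndpoint⇒¬Outside : ∀ {n} {C : Subset n} {ℓ ℓ'} → Inside C ℓ → ShareEndpoint ℓ ℓ' → ¬ Outside C ℓ'
Inside∧ShareEndpoint⇒¬Outside {C = C} {_ , _} {_ , _} (Cu , Cv) shared (Cx , Cy) with shared
... | inj₁ u≡x               = in-out-≢ {C = C} Cu Cx u≡x
... | inj₂ (inj₁ u≡y)        = in-out-≢ {C = C} Cu Cy u≡y
... | inj₂ (inj₂ (inj₁ v≡x)) = in-out-≢ {C = C} Cv Cx v≡x
... | inj₂ (inj₂ (inj₂ v≡y)) = in-out-≢ {C = C} Cv Cy v≡y

cut-link⇒connects-across : ∀ {n} {K : List (Link n)} {C} → DeltaNonempty K C → ConnectsAcross K C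
cut-link⇒connects-across {C = C} ((x , y) , ℓ∈K , cuts) with lookup C x in Cx | lookup C y in Cy
... | true  | false = x , y , Cx , Cy , (x , y) , (x , y) , inj₁ refl , inj₂ refl , here ℓ∈K
... | false | true  = y , x , Cy , Cx , (x , y) , (x , y) , inj₂ refl , inj₁ refl , here ℓ∈K
cut-link⇒connects-across (_ , _ , ()) | true  | true
cut-link⇒connects-across (_ , _ , ()) | false | false

-- Membership in C along the cycle, read periodically from vertex 0: the edges of
-- δ_E(C) are exactly the changes of this sequence on [0, n).
module _ {m : ℕ} (C : Subset (suc m)) where

  unroll : ℕ → Bool
  unroll k = lookup C (fromℕ< (m%n<n k (suc m)))

  unroll-toℕ : ∀ i → unroll (toℕ i) ≡ lookup C i
  unroll-toℕ i = cong (lookup C) (toℕ-injective (trans (toℕ-fromℕ< _) (m<n⇒m%n≡m (toℕ<n i))))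

  unroll-periodic : unroll (suc m) ≡ unroll 0
  unroll-periodic = cong (lookup C) (toℕ-injective
    (trans (toℕ-fromℕ< _) (trans (n%n≡0 (suc m)) (sym (toℕ-fromℕ< (m%n<n 0 (suc m)))))))

  cutSize≡changes : cutSize C ≡ changes unroll (suc m)
  cutSize≡changes = begin
    cutSize C
      ≡⟨ cong sum (map-tabulate id (λ i → change (lookup C i) (unroll (suc (toℕ i))))) ⟩
    sum (tabulate (λ (i : Fin (suc m)) → change (lookup C i) (unroll (suc (toℕ i)))))
      ≡⟨ cong sum (tabulate-cong (λ i → cong (λ b → change b (unroll (suc (toℕ i)))) (sym (unroll-toℕ i)))) ⟩
    sum (tabulate (λ (i : Fin (suc m)) → change (unroll (toℕ i)) (unroll (suc (toℕ i)))))
      ≡⟨ cong sum (tabulate-∘toℕ (suc m) (λ k → change (unroll k) (unroll (suc k)))) ⟩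
    changes unroll (suc m)
      ∎
    where open ≡-Reasoning

  -- Read around the cycle, u, x, v, y alternate in and out of C: four boundary edges.
  cutSize<4⇒¬interleaved : cutSize C < 4 → ∀ {u v x y}
    → lookup C u ≡ true → lookup C v ≡ true → lookup C x ≡ false → lookup C y ≡ false
    → OnPath₁ u v x → OnPath₂ u v y → ⊥
  cutSize<4⇒¬interleaved cut<4 {u} {v} {x} {y} Cu Cv Cx Cy (a≤x , x≤b) y-outside =
    <⇒≱ cut<4 (≤-trans (four-changes-around y-outside) (≤-reflexive (sym cutSize≡changes)))
    where
    a b : ℕ
    a = toℕ u ⊓ toℕ v
    b = toℕ u ⊔ toℕ v

    at-endpoint : ∀ {P : ℕ → Set} {k} → k ≡ toℕ u ⊎ k ≡ toℕ v → P (toℕ u) → P (toℕ v) → P k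
    at-endpoint (inj₁ refl) Pu _  = Pu
    at-endpoint (inj₂ refl) _  Pv = Pv

    in-a : unroll a ≡ true
    in-a = at-endpoint {P = λ k → unroll k ≡ true} (⊓-sel (toℕ u) (toℕ v))
             (trans (unroll-toℕ u) Cu) (trans (unroll-toℕ v) Cv)

    in-b : unroll b ≡ true
    in-b = at-endpoint {P = λ k → unroll k ≡ true} (⊔-sel (toℕ u) (toℕ v))
             (trans (unroll-toℕ u) Cu) (trans (unroll-toℕ v) Cv)

    b<n : b < suc m
    b<n = at-endpoint {P = _< suc m} (⊔-sel (toℕ u) (toℕ v)) (toℕ<n u) (toℕ<n v)

    out-x : unroll (toℕ x) ≡ false
    out-x = trans (unroll-toℕ x) Cx

    out-y : unroll (toℕ y) ≡ false
    out-y = trans (unroll-toℕ y) Cy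

    four-changes-around : (toℕ y ≤ a ⊎ b ≤ toℕ y) → 4 ≤ changes unroll (suc m)
    four-changes-around (inj₁ y≤a) =
      four-changes unroll y≤a a≤x x≤b (<⇒≤ b<n)
        (≢-sym (≡true∧≡false⇒≢ in-a out-y)) (≡true∧≡false⇒≢ in-a out-x) (≢-sym (≡true∧≡false⇒≢ in-b out-x))
        unroll-periodic
    four-changes-around (inj₂ b≤y) =
      four-changes unroll a≤x x≤b b≤y (<⇒≤ (toℕ<n y))
        (≡true∧≡false⇒≢ in-a out-x) (≢-sym (≡true∧≡false⇒≢ in-b out-x)) (≡true∧≡false⇒≢ in-b out-y)
        unroll-periodic

  Inside∧Cross⇒¬Outside : cutSize C < 4 → ∀ {ℓ ℓ'} → Inside C ℓ → Cross ℓ ℓ' → ¬ Outside C ℓ'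
  Inside∧Cross⇒¬Outside cut<4 {u , v} {x , y} (Cu , Cv) (_ , on₁ , on₂) (Cx , Cy) = crossing on₁ on₂
    where
    ¬interleaved : ∀ {w w'} → lookup C w ≡ false → lookup C w' ≡ false
      → OnPath₁ u v w → OnPath₂ u v w' → ⊥
    ¬interleaved = cutSize<4⇒¬interleaved cut<4 Cu Cv

    crossing : OnPath₁ u v x ⊎ OnPath₁ u v y → OnPath₂ u v x ⊎ OnPath₂ u v y → ⊥
    crossing (inj₁ x₁) (inj₁ x₂) = ¬interleaved Cx Cx x₁ x₂
    crossing (inj₁ x₁) (inj₂ y₂) = ¬interleaved Cx Cy x₁ y₂
    crossing (inj₂ y₁) (inj₁ x₂) = ¬interleaved Cy Cx y₁ x₂
    crossing (inj₂ y₁) (inj₂ y₂) = ¬interleaved Cy Cy y₁ y₂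

  Inside∧Intersect⇒¬Outside : cutSize C < 4 → ∀ {ℓ ℓ'} → Inside C ℓ → Intersect ℓ ℓ' → ¬ Outside C ℓ'
  Inside∧Intersect⇒¬Outside _     in-ℓ (inj₁ shared)  = Inside∧ShareEndpoint⇒¬Outside {C = C} in-ℓ shared
  Inside∧Intersect⇒¬Outside cut<4 in-ℓ (inj₂ crosses) = Inside∧Cross⇒¬Outside cut<4 in-ℓ crosses

  IGPath⇒cut-link : cutSize C < 4 → ∀ {K ℓ ℓ'} → IGPath K ℓ ℓ' → ¬ Outside C ℓ → ¬ Inside C ℓ'
    → DeltaNonempty K C
  IGPath⇒cut-link _ {ℓ = ℓ} (here ℓ∈K) ¬out ¬in with link-position C ℓ
  ... | inj₁ in-ℓ         = ⊥-elim (¬in in-ℓ)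
  ... | inj₂ (inj₁ out-ℓ) = ⊥-elim (¬out out-ℓ)
  ... | inj₂ (inj₂ cuts)  = ℓ , ℓ∈K , cuts
  IGPath⇒cut-link cut<4 {ℓ = ℓ} (step ℓ∈K meets path) ¬out ¬in with link-position C ℓ
  ... | inj₁ in-ℓ         = IGPath⇒cut-link cut<4 path (Inside∧Intersect⇒¬Outside cut<4 in-ℓ meets) ¬in
  ... | inj₂ (inj₁ out-ℓ) = ⊥-elim (¬out out-ℓ)
  ... | inj₂ (inj₂ cuts)  = ℓ , ℓ∈K , cuts

  connects-across⇒cut-link : cutSize C < 4 → ∀ {K} → ConnectsAcross K C → DeltaNonempty K C
  connects-across⇒cut-link cut<4 (_ , _ , Cv , Cw , _ , _ , v∈ℓ , w∈ℓ' , path) =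
    IGPath⇒cut-link cut<4 path (incident-in⇒¬Outside {C = C} Cv v∈ℓ) (incident-out⇒¬Inside {C = C} Cw w∈ℓ')

lemma28 : (n : ℕ) → 3 ≤ n → (L : List (Link n)) → All IsLink L → (c : Link n → ℚ)
    → (r : Fin n) → (er : Fin n) → EdgeAt r er
    → (K : List (Link n)) → K ⊆ L → (C : Subset n) → InCG r C
    → DeltaNonempty K C ⇔ (∃[ v ] ∃[ w ] (lookup C v ≡ true × lookup C w ≡ false × ConnectedIn K v w))
lemma28 (suc m) _ _ _ _ _ _ _ K _ C (_ , cut≡2) =
  mk⇔ (cut-link⇒connects-across {C = C}) (connects-across⇒cut-link C cut<4)
  where
  cut<4 : cutSize C < 4
  cut<4 = subst (_< 4) (sym cut≡2) (s≤s (s≤s (s≤s z≤n)))
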